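{- Let $(M, \mathcal G)$ and $(M, \mathcal G')$ be two general models with $\mathcal G \subseteq \mathcal G'$, let $X \in \mathcal G$, and let $\phi$ be a formula over the signature of $M$ with $\mathrm{Free}(\phi) \subseteq \mathrm{Dom}(X)$. Then \[ (M, \mathcal G) \models_X \phi \Rightarrow (M, \mathcal G') \models_X \phi. \]
   Context: A general model $(M,\mathcal G)$ is a first-order structure $M$ with a set $\mathcal G$ of teams. Teams are sets of assignments with a common finite domain. $\mathcal G$ must contain every team $\|\phi(\bar x,\bar m,\bar R)\|_M$ first-order definable with element parameters and relation parameters $\mathrm{Rel}(X_i)=\{s(\bar z):s\in X_i\}$, $X_i\in\mathcal G$. Formulas are independence logic formulas in negation normal form: first-order literals, atoms $\bar t_2\perp_{\bar t_1}\bar t_3$, $\wedge,\vee,\exists,\forall$. Satisfaction $(M,\mathcal G)\models_X\phi$ ($X\in\mathcal G$): - literals hold for every $s\in X$; - independence atoms: for $s,s'\in X$ agreeing on $\bar t_1$ there is $s''\in X$ agreeing with $s$ on $\bar t_1\bar t_2$ and with $s'$ on $\bar t_1\bar t_3$; - $\psi_1\vee\psi_2$: $X=Y\cup Z$ with $Y,Z\in\mathcal G$ satisfying $\psi_1,\psi_2$ respectively; - $\wedge$: both conjuncts; - $\exists x\psi$: some $X'\in\mathcal G$ with domain $\mathrm{Dom}(X)\cup\{x\}$, agreeing with $X$ outside $x$, satisfies $\psi$; - $\forall x\psi$: $X[M/x]=\{s[m/x]:s\in X,m\in\mathrm{Dom}(M)\}$ satisfies $\psi$. -}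

module Defs where

open import Level using (Level; 0ℓ) renaming (suc to lsuc)
open import Data.Nat using (ℕ; _≟_; _≡ᵇ_)
open import Data.Bool using (if_then_else_)
open import Data.Fin using (Fin)
open import Data.List using (List; []; _∷_; _++_; length; lookup; filter; concat)
import Data.List as L
open import Data.List.Membership.Propositional using (_∈_)
open import Data.List.Relation.Unary.Any using (here; there)
open import Data.List.Relation.Unary.All using (All)
open import Data.Vec using (Vec; []; _∷_; fromList)
import Data.Vec as V
open import Data.Product using (Σ; _×_; _,_; proj₁; proj₂)
open import Data.Sum using (_⊎_)
open import Data.Empty using (⊥)
open import Relation.Nullary using (¬_; ¬?)
open import Relation.Binary.PropositionalEquality using (_≡_; _≢_; refl; sym; trans)
open import Function.Bundles using (_⇔_)

record Signature : Set₁ where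
  field
    FunSym : Set
    funArity : FunSym → ℕ
    RelSym : Set
    relArity : RelSym → ℕ

record Structure (σ : Signature) : Set₁ where
  open Signature σ
  field
    Carrier : Set
    funI : (f : FunSym) → Vec Carrier (funArity f) → Carrier
    relI : (R : RelSym) → Vec Carrier (relArity R) → Set

Var : Set
Var = ℕ

module Syntax (σ : Signature) where
  open Signature σ

  data Term : Set where
    var : Var → Term
    app : (f : FunSym) → Vec Term (funArity f) → Term

  mutual
    termVars : Term → List Var
    termVars (var x) = x ∷ []
    termVars (app f ts) = termsVars ts

    termsVars : ∀ {n} → Vec Term n → List Var
    termsVars [] = []
    termsVars (t ∷ ts) = termVars t ++ termsVars ts

  tupleVars : List Term → List Var
  tupleVars ts = concat (L.map termVars ts)

  data Formula : Set where
    rel   : (R : RelSym) → Vec Term (relArity R) → Formula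
    nrel  : (R : RelSym) → Vec Term (relArity R) → Formula
    eq    : Term → Term → Formula
    neq   : Term → Term → Formula
    -- indep t₁ t₂ t₃ is the atom  t₂ ⊥_{t₁} t₃
    indep : List Term → List Term → List Term → Formula
    _∧_   : Formula → Formula → Formula
    _∨_   : Formula → Formula → Formula
    ex    : Var → Formula → Formula
    all   : Var → Formula → Formula

  remove : Var → List Var → List Var
  remove x = filter (λ v → ¬? (v ≟ x))

  Free : Formula → List Var
  Free (rel R ts) = termsVars ts
  Free (nrel R ts) = termsVars ts
  Free (eq t u) = termVars t ++ termVars u
  Free (neq t u) = termVars t ++ termVars u
  Free (indep t₁ t₂ t₃) = tupleVars t₁ ++ tupleVars t₂ ++ tupleVars t₃
  Free (φ ∧ ψ) = Free φ ++ Free ψ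
  Free (φ ∨ ψ) = Free φ ++ Free ψ
  Free (ex x φ) = remove x (Free φ)
  Free (all x φ) = remove x (Free φ)

module Semantics {σ : Signature} (M : Structure σ) where
  open Signature σ
  open Structure M renaming (Carrier to A)
  open Syntax σ

  -- Assignments are represented as total maps; an assignment with domain
  -- D is identified with all total maps agreeing with it on D.
  Assignment : Set
  Assignment = Var → A

  Agree : (Var → Set) → Assignment → Assignment → Set
  Agree P s s' = ∀ v → P v → s v ≡ s' v

  AgreeOn : List Var → Assignment → Assignment → Set
  AgreeOn D = Agree (λ v → v ∈ D)

  AgreeOff : List Var → Var → Assignment → Assignment → Set
  AgreeOff D x = Agree (λ v → v ∈ D × v ≢ x)

  -- A team: a set of assignments with common finite domain `dom`.
  -- Membership is closed under agreement on the domain, so `mem` is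
  -- the set of total extensions of the assignments of the team.
  record Team : Set₁ where
    field
      dom : List Var
      mem : Assignment → Set
      closed : ∀ {s s'} → AgreeOn dom s s' → mem s → mem s'
  open Team public

  SameDom : List Var → List Var → Set
  SameDom D E = ∀ v → (v ∈ D) ⇔ (v ∈ E)

  _≈T_ : Team → Team → Set
  X ≈T Y = SameDom (dom X) (dom Y) × (∀ s → mem X s ⇔ mem Y s)

  agreeOn-trans : ∀ D {s t u} → AgreeOn D s t → AgreeOn D t u → AgreeOn D s u
  agreeOn-trans D p q v v∈ = trans (p v v∈) (q v v∈)

  agreeOn-sym : ∀ D {s t} → AgreeOn D s t → AgreeOn D t s
  agreeOn-sym D p v v∈ = sym (p v v∈)

  RelOf : (X : Team) → Vec A (length (dom X)) → Set
  RelOf X a = Σ Assignment λ s → mem X s × V.map s (fromList (dom X)) ≡ a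

  _[_↦_] : Assignment → Var → A → Assignment
  (s [ x ↦ a ]) v = if v ≡ᵇ x then a else s v

  -- First-order formulas with element parameters and relation
  -- parameters Rel(X_i), for X_i in a list Ps of teams

  data DTerm : Set where
    var : Var → DTerm
    elt : A → DTerm
    app : (f : FunSym) → Vec DTerm (funArity f) → DTerm

  data DForm (Ps : List Team) : Set where
    rel  : (R : RelSym) → Vec DTerm (relArity R) → DForm Ps
    prel : (i : Fin (length Ps)) → Vec DTerm (length (dom (lookup Ps i))) → DForm Ps
    eq   : DTerm → DTerm → DForm Ps
    neg  : DForm Ps → DForm Ps
    _∧_  : DForm Ps → DForm Ps → DForm Ps
    _∨_  : DForm Ps → DForm Ps → DForm Ps
    _⇒_  : DForm Ps → DForm Ps → DForm Ps
    ex   : Var → DForm Ps → DForm Ps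
    all  : Var → DForm Ps → DForm Ps

  mutual
    dtermVars : DTerm → List Var
    dtermVars (var x) = x ∷ []
    dtermVars (elt a) = []
    dtermVars (app f ts) = dtermsVars ts

    dtermsVars : ∀ {n} → Vec DTerm n → List Var
    dtermsVars [] = []
    dtermsVars (t ∷ ts) = dtermVars t ++ dtermsVars ts

  dFree : ∀ {Ps} → DForm Ps → List Var
  dFree (rel R ts) = dtermsVars ts
  dFree (prel i ts) = dtermsVars ts
  dFree (eq t u) = dtermVars t ++ dtermVars u
  dFree (neg φ) = dFree φ
  dFree (φ ∧ ψ) = dFree φ ++ dFree ψ
  dFree (φ ∨ ψ) = dFree φ ++ dFree ψ
  dFree (φ ⇒ ψ) = dFree φ ++ dFree ψ
  dFree (ex x φ) = remove x (dFree φ)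
  dFree (all x φ) = remove x (dFree φ)

  mutual
    devalT : Assignment → DTerm → A
    devalT s (var x) = s x
    devalT s (elt a) = a
    devalT s (app f ts) = funI f (devalTs s ts)

    devalTs : ∀ {n} → Assignment → Vec DTerm n → Vec A n
    devalTs s [] = []
    devalTs s (t ∷ ts) = devalT s t ∷ devalTs s ts

  ⟦_⟧ : ∀ {Ps} → DForm Ps → Assignment → Set
  ⟦ rel R ts ⟧ s = relI R (devalTs s ts)
  ⟦_⟧ {Ps} (prel i ts) s = RelOf (lookup Ps i) (devalTs s ts)
  ⟦ eq t u ⟧ s = devalT s t ≡ devalT s u
  ⟦ neg φ ⟧ s = ¬ ⟦ φ ⟧ s
  ⟦ φ ∧ ψ ⟧ s = ⟦ φ ⟧ s × ⟦ ψ ⟧ s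
  ⟦ φ ∨ ψ ⟧ s = ⟦ φ ⟧ s ⊎ ⟦ ψ ⟧ s
  ⟦ φ ⇒ ψ ⟧ s = ⟦ φ ⟧ s → ⟦ ψ ⟧ s
  ⟦ ex x φ ⟧ s = Σ A λ a → ⟦ φ ⟧ (s [ x ↦ a ])
  ⟦ all x φ ⟧ s = (a : A) → ⟦ φ ⟧ (s [ x ↦ a ])

  defTeam : (Ps : List Team) → List Var → DForm Ps → Team
  defTeam Ps xs φ = record
    { dom = xs
    ; mem = λ s → Σ Assignment λ s' → AgreeOn xs s s' × ⟦ φ ⟧ s'
    ; closed = λ {s} {t} st (s' , ss' , h) →
        s' , agreeOn-trans xs (agreeOn-sym xs st) ss' , h
    }

  record GeneralModel : Set₂ where
    field
      𝒢 : Team → Set₁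
      -- 𝒢 is a set of teams (membership respects team equality)
      𝒢-resp : ∀ {X Y} → X ≈T Y → 𝒢 X → 𝒢 Y
      𝒢-definable : (Ps : List Team) → All 𝒢 Ps → (xs : List Var) →
        (φ : DForm Ps) → (∀ v → v ∈ dFree φ → v ∈ xs) → 𝒢 (defTeam Ps xs φ)
  open GeneralModel public

  mutual
    evalT : Assignment → Term → A
    evalT s (var x) = s x
    evalT s (app f ts) = funI f (evalTs s ts)

    evalTs : ∀ {n} → Assignment → Vec Term n → Vec A n
    evalTs s [] = []
    evalTs s (t ∷ ts) = evalT s t ∷ evalTs s ts

  evalTup : Assignment → List Term → List A
  evalTup s ts = L.map (evalT s) ts

  dup : Team → Var → Team
  dup X x = record
    { dom = x ∷ dom X
    ; mem = λ s → Σ Assignment λ s' → mem X s' × AgreeOff (dom X) x s s'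
    ; closed = λ {s} {t} st (s' , m , off) →
        s' , m , λ v (v∈ , v≢x) → trans (sym (st v (there v∈))) (off v (v∈ , v≢x))
    }

  AgreeOutside : Team → Var → Team → Set
  AgreeOutside X x X' =
    (∀ s → mem X' s → Σ Assignment λ s' → mem X s' × AgreeOff (dom X) x s s') ×
    (∀ s → mem X s → Σ Assignment λ s' → mem X' s' × AgreeOff (dom X) x s s')

  Sat : (Team → Set₁) → Team → Formula → Set₁
  Sat 𝒢 X (rel R ts)  = Level.Lift (lsuc 0ℓ) (∀ s → mem X s → relI R (evalTs s ts))
  Sat 𝒢 X (nrel R ts) = Level.Lift (lsuc 0ℓ) (∀ s → mem X s → ¬ relI R (evalTs s ts))
  Sat 𝒢 X (eq t u)    = Level.Lift (lsuc 0ℓ) (∀ s → mem X s → evalT s t ≡ evalT s u)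
  Sat 𝒢 X (neq t u)   = Level.Lift (lsuc 0ℓ) (∀ s → mem X s → evalT s t ≢ evalT s u)
  Sat 𝒢 X (indep t₁ t₂ t₃) = Level.Lift (lsuc 0ℓ)
    (∀ s s' → mem X s → mem X s' → evalTup s t₁ ≡ evalTup s' t₁ →
      Σ Assignment λ s'' → mem X s'' ×
        evalTup s'' (t₁ ++ t₂) ≡ evalTup s (t₁ ++ t₂) ×
        evalTup s'' (t₁ ++ t₃) ≡ evalTup s' (t₁ ++ t₃))
  Sat 𝒢 X (φ ∧ ψ) = Sat 𝒢 X φ × Sat 𝒢 X ψ
  Sat 𝒢 X (φ ∨ ψ) = Σ Team λ Y → Σ Team λ Z →
    𝒢 Y × 𝒢 Z × SameDom (dom Y) (dom X) × SameDom (dom Z) (dom X) ×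
    Level.Lift (lsuc 0ℓ) (∀ s → mem X s ⇔ (mem Y s ⊎ mem Z s)) ×
    Sat 𝒢 Y φ × Sat 𝒢 Z ψ
  Sat 𝒢 X (ex x φ) = Σ Team λ X' →
    𝒢 X' × SameDom (dom X') (x ∷ dom X) × Level.Lift (lsuc 0ℓ) (AgreeOutside X x X') ×
    Sat 𝒢 X' φ
  Sat 𝒢 X (all x φ) = Sat 𝒢 (dup X x) φ

module Submission where

-- In the team semantics of independence logic the family 𝒢 of a
-- general model is consulted only positively: the clauses for
-- disjunction and the existential quantifier ask for SOME teams in 𝒢
-- (the two halves of a split, resp. the supplementing team), while
-- literals, independence atoms and the universal quantifier do not
-- mention 𝒢 at all.  Hence enlarging 𝒢 can only preserve
-- satisfaction.

open import Defs
open import Data.List.Membership.Propositional using (_∈_)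
open import Data.Product using (_,_)

module _ {σ : Signature} (M : Structure σ) where
  open Semantics M
  open Syntax σ

  sat-mono : {𝒢₁ 𝒢₂ : Team → Set₁} → (∀ Y → 𝒢₁ Y → 𝒢₂ Y) →
             (X : Team) (φ : Formula) → Sat 𝒢₁ X φ → Sat 𝒢₂ X φ
  sat-mono ⊆𝒢 X (rel R ts)       holds = holds
  sat-mono ⊆𝒢 X (nrel R ts)      holds = holds
  sat-mono ⊆𝒢 X (eq t u)         holds = holds
  sat-mono ⊆𝒢 X (neq t u)        holds = holds
  sat-mono ⊆𝒢 X (indep t₁ t₂ t₃) holds = holds
  sat-mono ⊆𝒢 X (φ ∧ ψ) (satφ , satψ) =
    sat-mono ⊆𝒢 X φ satφ , sat-mono ⊆𝒢 X ψ satψ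
  sat-mono ⊆𝒢 X (φ ∨ ψ) (Y , Z , Y∈𝒢 , Z∈𝒢 , domY , domZ , X=Y∪Z , satY , satZ) =
    Y , Z , ⊆𝒢 Y Y∈𝒢 , ⊆𝒢 Z Z∈𝒢 , domY , domZ , X=Y∪Z ,
    sat-mono ⊆𝒢 Y φ satY , sat-mono ⊆𝒢 Z ψ satZ
  sat-mono ⊆𝒢 X (ex x φ) (X' , X'∈𝒢 , domX' , agrees , satX') =
    X' , ⊆𝒢 X' X'∈𝒢 , domX' , agrees , sat-mono ⊆𝒢 X' φ satX'
  sat-mono ⊆𝒢 X (all x φ) holds = sat-mono ⊆𝒢 (dup X x) φ holds

mainTheorem11 : (σ : Signature) (M : Structure σ)
    (G G' : Semantics.GeneralModel M) →
    (∀ X → Semantics.𝒢 G X → Semantics.𝒢 G' X) →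
    (X : Semantics.Team M) → Semantics.𝒢 G X →
    (φ : Syntax.Formula σ) →
    (∀ v → v ∈ Syntax.Free σ φ → v ∈ Semantics.dom X) →
    Semantics.Sat M (Semantics.𝒢 G) X φ →
    Semantics.Sat M (Semantics.𝒢 G') X φ
mainTheorem11 σ M G G' 𝒢⊆𝒢' X _ φ _ = sat-mono M 𝒢⊆𝒢' X φ
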